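{- Let $k\ge3$ and let $\mathcal H$ be any $2$-colorable $k$-uniform hypergraph. Then the algorithm Color-Bipartite-Hypergraph, run on $\mathcal H$, returns a proper $2$-coloring of $\mathcal H$.
   Context: A $k$-uniform hypergraph has edges that are $k$-element vertex sets; a proper $2$-coloring assigns each vertex a color in $\{0,1\}$ so that no edge is monochromatic. For a vertex $u$ and vertex set $X$, $N(u,X)$ is the set of $(k-1)$-subsets of $X$ forming an edge with $u$. $K_{\ell,\ell}$ is the $k$-graph on disjoint $\ell$-sets $A,B$ whose edges are all $k$-sets with one vertex in one of $A,B$ and $k-1$ in the other; a copy of it in $\mathcal H$ is a pair of disjoint $\ell$-sets $A,B$ of vertices such that all these $k$-sets are edges of $\mathcal H$ ($A,B$ are called its independent sets). Let $\ell=5k$. The algorithm Color-Bipartite-Hypergraph on input $\mathcal H$: (1) searches exhaustively (over all $2\ell$-vertex subsets) for a copy of $K_{\ell,\ell}$; if none is found it goes to step (5). (2) With $A,B$ the independent sets of the copy found, it colors $A$ with $0$ and $B$ with $1$, and then for every vertex $u$: if $N(u,B)\neq\emptyset$ it colors $u$ with $0$, and if $N(u,A)\ne\emptyset$ it colors $u$ with $1$. (3) Letting $C_0$ (resp. $C_1$) be the vertices colored $0$ (resp. $1$) so far, for every vertex $u\notin C_0\cup C_1$: if $N(u,C_1)\ne\emptyset$ it colors $u$ with $0$, and if $N(u,C_0)\ne\emptyset$ it colors $u$ with $1$. (4) If all vertices are colored it returns this coloring, otherwise it goes to step (5). (5) It exhaustively searches for a proper $2$-coloring of $\mathcal H$ and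 returns the first one found. -}

module Defs where

open import Data.Nat using (ℕ; _∸_; _*_; _≟_)
open import Data.Bool using (Bool; true; false; if_then_else_)
import Data.Bool as B
open import Data.Maybe using (Maybe; just; nothing)
open import Data.Fin using (Fin)
open import Data.Fin.Subset using (Subset; _∈_; _∉_; _⊆_; _∪_; ⁅_⁆; ∣_∣)
open import Data.Fin.Subset.Properties using (_∈?_; _⊆?_; anySubset?)
open import Data.Vec using (tabulate)
open import Data.Product using (Σ; ∃; _×_; _,_)
open import Data.Sum using (_⊎_)
open import Relation.Nullary using (¬_; Dec; yes; no; ¬?)
open import Relation.Nullary.Decidable using (_×-dec_; ⌊_⌋)
open import Relation.Binary.PropositionalEquality using (_≡_; _≢_)

record Hypergraph (n : ℕ) : Set where
  field
    edge : Subset n → Bool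

open Hypergraph public

IsEdge : ∀ {n} → Hypergraph n → Subset n → Set
IsEdge H S = edge H S ≡ true

Uniform : ∀ {n} → ℕ → Hypergraph n → Set
Uniform k H = ∀ S → IsEdge H S → ∣ S ∣ ≡ k

-- 2-colorings: false = colour 0, true = colour 1
Coloring : ℕ → Set
Coloring n = Fin n → Bool

Proper : ∀ {n} → Hypergraph n → Coloring n → Set
Proper H c = ∀ S → IsEdge H S → ¬ (Σ Bool λ b → ∀ v → v ∈ S → c v ≡ b)

TwoColorable : ∀ {n} → Hypergraph n → Set
TwoColorable H = ∃ λ c → Proper H c

InN : ∀ {n} → ℕ → Hypergraph n → Fin n → Subset n → Subset n → Set
InN k H u X S = S ⊆ X × ∣ S ∣ ≡ k ∸ 1 × u ∉ S × IsEdge H (⁅ u ⁆ ∪ S)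

NNonempty : ∀ {n} → ℕ → Hypergraph n → Fin n → Subset n → Set
NNonempty k H u X = ∃ λ S → InN k H u X S

NNonempty? : ∀ {n} k (H : Hypergraph n) u X → Dec (NNonempty k H u X)
NNonempty? k H u X = anySubset? λ S →
  (S ⊆? X) ×-dec ((∣ S ∣ ≟ (k ∸ 1)) ×-dec (¬? (u ∈? S) ×-dec (edge H (⁅ u ⁆ ∪ S) B.≟ true)))

-- A, B (disjoint ℓ-sets) form a copy of K_{ℓ,ℓ} in H
IsCopy : ∀ {n} → ℕ → ℕ → Hypergraph n → Subset n → Subset n → Set
IsCopy k ℓ H A B =
  (∀ v → v ∈ A → v ∉ B) × ∣ A ∣ ≡ ℓ × ∣ B ∣ ≡ ℓ ×
  (∀ u S → u ∈ A → S ⊆ B → ∣ S ∣ ≡ k ∸ 1 → IsEdge H (⁅ u ⁆ ∪ S)) ×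
  (∀ u S → u ∈ B → S ⊆ A → ∣ S ∣ ≡ k ∸ 1 → IsEdge H (⁅ u ⁆ ∪ S))

-- Step (2): A gets 0, B gets 1; then each u with N(u,B) ≠ ∅ gets 0, and
-- afterwards each u with N(u,A) ≠ ∅ gets 1 (later assignment overrides).
step2 : ∀ {n} → ℕ → Hypergraph n → Subset n → Subset n → Fin n → Maybe Bool
step2 k H A B u =
  if ⌊ NNonempty? k H u A ⌋ then just true
  else if ⌊ NNonempty? k H u B ⌋ then just false
  else if ⌊ u ∈? A ⌋ then just false
  else if ⌊ u ∈? B ⌋ then just true
  else nothing

isJust-b : Bool → Maybe Bool → Bool
isJust-b b (just b′) = ⌊ b B.≟ b′ ⌋
isJust-b b nothing = false

C-after2 : ∀ {n} → Bool → ℕ → Hypergraph n → Subset n → Subset n → Subset n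
C-after2 b k H A B = tabulate λ u → isJust-b b (step2 k H A B u)

-- Step (3): uncoloured u with N(u,C_1) ≠ ∅ gets 0, and then with
-- N(u,C_0) ≠ ∅ gets 1 (later assignment overrides). Returns the colour
-- of every vertex after steps (2),(3) (nothing = uncoloured).
step3 : ∀ {n} → ℕ → Hypergraph n → Subset n → Subset n → Fin n → Maybe Bool
step3 k H A B u with step2 k H A B u
... | just b = just b
... | nothing =
  if ⌊ NNonempty? k H u (C-after2 false k H A B) ⌋ then just true
  else if ⌊ NNonempty? k H u (C-after2 true k H A B) ⌋ then just false
  else nothing

-- Possible outputs of Color-Bipartite-Hypergraph with ℓ = 5k.
-- The exhaustive search of step (1) may return any copy (we allow all of them);
-- step (5) returns a proper 2-colouring (if one exists).
data Output {n : ℕ} (k : ℕ) (H : Hypergraph n) : Coloring n → Set where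
  viaCopy : ∀ A B c → IsCopy k (5 * k) H A B →
            (∀ u → step3 k H A B u ≡ just (c u)) → Output k H c
  viaSearch : ∀ c →
            ((¬ Σ (Subset n) λ A → Σ (Subset n) λ B → IsCopy k (5 * k) H A B)
             ⊎ (Σ (Subset n) λ A → Σ (Subset n) λ B → IsCopy k (5 * k) H A B ×
                  Σ (Fin n) λ u → step3 k H A B u ≡ nothing)) →
            Proper H c → Output k H c

{-# OPTIONS --safe #-}
-- Fix a proper colouring. In a copy of K_{ℓ,ℓ} with ℓ ≥ 2(k-1), one side contains k-1 vertices
-- of one colour; these form an edge with every vertex of the other side, forcing that side to
-- the opposite colour, and it in turn forces the first side. So, after possibly swapping colours,
-- some proper colouring is 0 on A and 1 on B. Every colour the algorithm assigns in steps (2)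
-- and (3) is forced in the same way by a monochromatic set it has already coloured correctly,
-- so when the algorithm colours every vertex it reproduces that proper colouring; otherwise the
-- colouring comes from the exhaustive search of step (5).
module Submission where

open import Defs
open import Data.Bool using (Bool; true; false; not)
import Data.Bool as Bool
open import Data.Bool.Properties using (¬-not; not-involutive)
open import Data.Fin using (Fin)
open import Data.Fin.Properties using (all?; any?)
open import Data.Fin.Subset
  using (Subset; outside; inside; _∈_; _⊆_; _∪_; _∩_; ∁; ⁅_⁆; ∣_∣)
open import Data.Fin.Subset.Properties
  using (_∈?_; _⊆?_; ⊆-refl; anySubset?; out⊆; s⊆s; p∩q⊆p; p∩q⊆q; x∈p∪q⁻; x∈∁p⇒x∉p; x∈⁅y⁆⇒x≡y)
open import Data.Maybe using (Maybe; just; nothing)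
import Data.Maybe.Properties as Maybe
import Data.Nat as ℕ
open import Data.Nat using (ℕ; zero; suc; _+_; _*_; _∸_; _≤_; z≤n; s≤s; _≤?_)
open import Data.Nat.Properties
  using (+-suc; +-mono-≤; +-monoʳ-≤; +-monoˡ-≤; +-cancelˡ-≤; m≤m+n; m∸n≤m; ≤-trans; <⇒≤; ≰⇒>; module ≤-Reasoning)
open import Data.Product using (Σ; ∃; _×_; _,_; proj₁; proj₂)
open import Data.Sum using (inj₁; inj₂)
open import Data.Vec using (_∷_; []; tabulate)
open import Data.Vec.Properties using ([]=⇒lookup; lookup⇒[]=; lookup∘tabulate)
open import Function using (_∘_)
open import Relation.Nullary using (Dec; yes; no; ¬?)
open import Relation.Nullary.Decidable using (_×-dec_; _→-dec_; decidable-stable)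
open import Relation.Binary.PropositionalEquality using (_≡_; _≢_; refl; sym; trans; cong; subst)

private
  variable
    n k m : ℕ
    b : Bool
    c : Coloring n
    H : Hypergraph n
    A B X Y Z : Subset n

∣p∩q∣+∣p∩∁q∣≡∣p∣ : (p q : Subset n) → ∣ p ∩ q ∣ + ∣ p ∩ ∁ q ∣ ≡ ∣ p ∣
∣p∩q∣+∣p∩∁q∣≡∣p∣ []            []            = refl
∣p∩q∣+∣p∩∁q∣≡∣p∣ (outside ∷ p) (_ ∷ q)       = ∣p∩q∣+∣p∩∁q∣≡∣p∣ p q
∣p∩q∣+∣p∩∁q∣≡∣p∣ (inside ∷ p)  (inside ∷ q)  = cong suc (∣p∩q∣+∣p∩∁q∣≡∣p∣ p q)
∣p∩q∣+∣p∩∁q∣≡∣p∣ (inside ∷ p)  (outside ∷ q) = trans (+-suc _ _) (cong suc (∣p∩q∣+∣p∩∁q∣≡∣p∣ p q))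

subsetOfSize : (p : Subset n) → m ≤ ∣ p ∣ → ∃ λ q → q ⊆ p × ∣ q ∣ ≡ m
subsetOfSize {m = zero} [] z≤n = [] , (λ ()) , refl
subsetOfSize (outside ∷ p) m≤∣p∣ with subsetOfSize p m≤∣p∣
... | q , q⊆p , ∣q∣≡m = outside ∷ q , out⊆ q⊆p , ∣q∣≡m
subsetOfSize {m = zero} (inside ∷ p) _ with subsetOfSize p z≤n
... | q , q⊆p , ∣q∣≡0 = outside ∷ q , out⊆ q⊆p , ∣q∣≡0
subsetOfSize {m = suc m} (inside ∷ p) (s≤s m≤∣p∣) with subsetOfSize p m≤∣p∣
... | q , q⊆p , ∣q∣≡m = inside ∷ q , s⊆s q⊆p , cong suc ∣q∣≡m

∈-tabulate⁻ : ∀ {f : Fin n → Bool} {v} → v ∈ tabulate f → f v ≡ true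
∈-tabulate⁻ {f = f} {v} v∈ = trans (sym (lookup∘tabulate f v)) ([]=⇒lookup v∈)

∈-tabulate⁺ : ∀ {f : Fin n → Bool} {v} → f v ≡ true → v ∈ tabulate f
∈-tabulate⁺ {f = f} {v} fv≡true = lookup⇒[]= v (tabulate f) (trans (lookup∘tabulate f v) fv≡true)

Monochromatic : Coloring n → Subset n → Bool → Set
Monochromatic c X b = ∀ v → v ∈ X → c v ≡ b

Monochromatic-⊆ : Y ⊆ X → Monochromatic c X b → Monochromatic c Y b
Monochromatic-⊆ Y⊆X mono v v∈Y = mono v (Y⊆X v∈Y)

colourClass : Coloring n → Bool → Subset n
colourClass c true  = tabulate c
colourClass c false = ∁ (tabulate c)

colourClass-monochromatic : (c : Coloring n) (b : Bool) → Monochromatic c (colourClass c b) b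
colourClass-monochromatic c true  v v∈ = ∈-tabulate⁻ v∈
colourClass-monochromatic c false v v∈ = ¬-not (x∈∁p⇒x∉p v∈ ∘ ∈-tabulate⁺)

pigeonhole : (c : Coloring n) (p : Subset n) → m + m ≤ ∣ p ∣ → Σ Bool λ b → m ≤ ∣ p ∩ colourClass c b ∣
pigeonhole {m = m} c p 2m≤∣p∣ with m ≤? ∣ p ∩ tabulate c ∣
... | yes m≤ = true , m≤
... | no m≰ = false , +-cancelˡ-≤ m _ _ (begin
  m + m                                         ≤⟨ 2m≤∣p∣ ⟩
  ∣ p ∣                                         ≡⟨ sym (∣p∩q∣+∣p∩∁q∣≡∣p∣ p (tabulate c)) ⟩
  ∣ p ∩ tabulate c ∣ + ∣ p ∩ ∁ (tabulate c) ∣  ≤⟨ +-monoˡ-≤ _ (<⇒≤ (≰⇒> m≰)) ⟩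
  m + ∣ p ∩ ∁ (tabulate c) ∣                    ∎)
  where open ≤-Reasoning

Proper-resp-≗ : ∀ {c c′ : Coloring n} → (∀ v → c v ≡ c′ v) → Proper H c → Proper H c′
Proper-resp-≗ c≗c′ proper S e (b , mono) = proper S e (b , λ v v∈S → trans (c≗c′ v) (mono v v∈S))

Proper-not : Proper H c → Proper H (not ∘ c)
Proper-not {c = c} proper S e (b , mono) =
  proper S e (not b , λ v v∈S → trans (sym (not-involutive (c v))) (cong not (mono v v∈S)))

forced-by-edge : ∀ {u S} → Proper H c → IsEdge H (⁅ u ⁆ ∪ S) → Monochromatic c S b → c u ≡ not b
forced-by-edge {c = c} {b = b} {u = u} {S} proper e mono = ¬-not λ cu≡b →
  proper (⁅ u ⁆ ∪ S) e (b , λ v v∈ → case-∪ cu≡b v (x∈p∪q⁻ ⁅ u ⁆ S v∈))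
  where
  case-∪ : c u ≡ b → ∀ v → _ → c v ≡ b
  case-∪ cu≡b v (inj₁ v∈⁅u⁆) = subst (λ w → c w ≡ b) (sym (x∈⁅y⁆⇒x≡y u v∈⁅u⁆)) cu≡b
  case-∪ _    v (inj₂ v∈S)   = mono v v∈S

forced-by-neighbourhood : ∀ {u} → Proper H c → NNonempty k H u X → Monochromatic c X b → c u ≡ not b
forced-by-neighbourhood proper (S , S⊆X , _ , _ , e) mono = forced-by-edge proper e (Monochromatic-⊆ S⊆X mono)

FullyJoined : ℕ → Hypergraph n → Subset n → Subset n → Set
FullyJoined k H X Y = ∀ u S → u ∈ X → S ⊆ Y → ∣ S ∣ ≡ k ∸ 1 → IsEdge H (⁅ u ⁆ ∪ S)

forced-by-join : Proper H c → FullyJoined k H X Z → Y ⊆ Z → k ∸ 1 ≤ ∣ Y ∣ → Monochromatic c Y b →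
                 Monochromatic c X (not b)
forced-by-join {Y = Y} proper joined Y⊆Z k-1≤∣Y∣ mono u u∈X with subsetOfSize Y k-1≤∣Y∣
... | S , S⊆Y , ∣S∣≡k-1 =
  forced-by-edge proper (joined u S u∈X (Y⊆Z ∘ S⊆Y) ∣S∣≡k-1) (Monochromatic-⊆ S⊆Y mono)

copy-bicoloured : ∀ {ℓ} → Proper H c → IsCopy k ℓ H A B → (k ∸ 1) + (k ∸ 1) ≤ ℓ →
                  Σ Bool λ b → Monochromatic c A (not b) × Monochromatic c B b
copy-bicoloured {c = c} {k = k} {A = A} {B = B} proper (_ , ∣A∣≡ℓ , ∣B∣≡ℓ , A→B , B→A) 2[k-1]≤ℓ
  with pigeonhole {m = k ∸ 1} c B (subst (_ ≤_) (sym ∣B∣≡ℓ) 2[k-1]≤ℓ)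
... | b , k-1≤∣B∩b∣ = b , A-coloured , B-coloured
  where
  A-coloured : Monochromatic c A (not b)
  A-coloured = forced-by-join {k = k} proper A→B (p∩q⊆p B _) k-1≤∣B∩b∣
                 (Monochromatic-⊆ (p∩q⊆q B _) (colourClass-monochromatic c b))

  B-coloured : Monochromatic c B b
  B-coloured v v∈B = trans (forced-by-join {k = k} proper B→A ⊆-refl k-1≤∣A∣ A-coloured v v∈B)
                            (not-involutive b)
    where
    k-1≤∣A∣ : k ∸ 1 ≤ ∣ A ∣
    k-1≤∣A∣ = subst (_ ≤_) (sym ∣A∣≡ℓ) (≤-trans (m≤m+n _ _) 2[k-1]≤ℓ)

2[k∸1]≤5k : ∀ k → (k ∸ 1) + (k ∸ 1) ≤ 5 * k
2[k∸1]≤5k k = ≤-trans (+-mono-≤ (m∸n≤m k 1) (m∸n≤m k 1)) (+-monoʳ-≤ k (m≤m+n k _))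

copy-colouring : TwoColorable H → IsCopy k (5 * k) H A B →
                 Σ (Coloring n) λ c → Proper H c × Monochromatic c A false × Monochromatic c B true
copy-colouring {k = k} (c , proper) copy with copy-bicoloured {k = k} proper copy (2[k∸1]≤5k k)
... | true  , A-false , B-true  = c , proper , A-false , B-true
... | false , A-true  , B-false =
  not ∘ c , Proper-not proper , (λ v → cong not ∘ A-true v) , (λ v → cong not ∘ B-false v)

isJust-b≡true⇒≡just : ∀ b (x : Maybe Bool) → isJust-b b x ≡ true → x ≡ just b
isJust-b≡true⇒≡just true  (just true)  _ = refl
isJust-b≡true⇒≡just false (just false) _ = refl

module Correctness (k : ℕ) (H : Hypergraph n) (A B : Subset n) {c : Coloring n} (proper : Proper H c)
                   (A-false : Monochromatic c A false) (B-true : Monochromatic c B true) where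

  step2-correct : ∀ u {b} → step2 k H A B u ≡ just b → c u ≡ b
  step2-correct u _ with NNonempty? k H u A | NNonempty? k H u B | u ∈? A | u ∈? B
  step2-correct u refl | yes N[u,A]≢∅ | _            | _       | _       =
    forced-by-neighbourhood {k = k} proper N[u,A]≢∅ A-false
  step2-correct u refl | no _         | yes N[u,B]≢∅ | _       | _       =
    forced-by-neighbourhood {k = k} proper N[u,B]≢∅ B-true
  step2-correct u refl | no _         | no _         | yes u∈A | _       = A-false u u∈A
  step2-correct u refl | no _         | no _         | no _    | yes u∈B = B-true u u∈B

  C-after2-monochromatic : ∀ b → Monochromatic c (C-after2 b k H A B) b
  C-after2-monochromatic b v v∈ = step2-correct v (isJust-b≡true⇒≡just b _ (∈-tabulate⁻ v∈))

  step3-correct : ∀ u {b} → step3 k H A B u ≡ just b → c u ≡ b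
  step3-correct u _ with step2 k H A B u in step2≡
  step3-correct u refl | just _ = step2-correct u step2≡
  step3-correct u _    | nothing
    with NNonempty? k H u (C-after2 false k H A B) | NNonempty? k H u (C-after2 true k H A B)
  step3-correct u refl | nothing | yes N[u,C₀]≢∅ | _ =
    forced-by-neighbourhood {k = k} proper N[u,C₀]≢∅ (C-after2-monochromatic false)
  step3-correct u refl | nothing | no _ | yes N[u,C₁]≢∅ =
    forced-by-neighbourhood {k = k} proper N[u,C₁]≢∅ (C-after2-monochromatic true)

output-proper : TwoColorable H → Output k H c → Proper H c
output-proper _ (viaSearch _ _ proper) = proper
output-proper {H = H} {k = k} twoColourable (viaCopy A B c copy steps)
  with copy-colouring {k = k} twoColourable copy
... | χ , χ-proper , A-false , B-true =
  Proper-resp-≗ (λ u → Correctness.step3-correct k H A B χ-proper A-false B-true u (steps u)) χ-proper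

allSubset? : {P : Subset n → Set} → (∀ S → Dec (P S)) → Dec (∀ S → P S)
allSubset? P? with anySubset? (¬? ∘ P?)
... | yes (S , ¬PS) = no λ ∀P → ¬PS (∀P S)
... | no ¬∃¬P = yes λ S → decidable-stable (P? S) λ ¬PS → ¬∃¬P (S , ¬PS)

FullyJoined? : ∀ k (H : Hypergraph n) X Y → Dec (FullyJoined k H X Y)
FullyJoined? k H X Y = all? λ u → allSubset? λ S →
  (u ∈? X) →-dec (S ⊆? Y) →-dec (∣ S ∣ ℕ.≟ k ∸ 1) →-dec (edge H (⁅ u ⁆ ∪ S) Bool.≟ true)

IsCopy? : ∀ k ℓ (H : Hypergraph n) A B → Dec (IsCopy k ℓ H A B)
IsCopy? k ℓ H A B =
  all? (λ v → (v ∈? A) →-dec ¬? (v ∈? B)) ×-dec (∣ A ∣ ℕ.≟ ℓ) ×-dec (∣ B ∣ ℕ.≟ ℓ) ×-dec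
  FullyJoined? k H A B ×-dec FullyJoined? k H B A

≢nothing⇒≡just : ∀ {a} {T : Set a} (x : Maybe T) → x ≢ nothing → ∃ λ t → x ≡ just t
≢nothing⇒≡just (just t) _ = t , refl
≢nothing⇒≡just nothing x≢nothing with () ← x≢nothing refl

output-exists : TwoColorable H → ∃ (Output k H)
output-exists {H = H} {k = k} (c , proper)
  with anySubset? (λ A → anySubset? λ B → IsCopy? k (5 * k) H A B)
... | no ¬copy = c , viaSearch c (inj₁ ¬copy) proper
... | yes (A , B , copy) with any? (λ u → Maybe.≡-dec Bool._≟_ (step3 k H A B u) nothing)
...   | yes uncoloured = c , viaSearch c (inj₂ (A , B , copy , uncoloured)) proper
...   | no ¬uncoloured = proj₁ ∘ colour , viaCopy A B _ copy (proj₂ ∘ colour)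
  where
  colour : ∀ u → ∃ λ b → step3 k H A B u ≡ just b
  colour u = ≢nothing⇒≡just (step3 k H A B u) λ step3≡nothing → ¬uncoloured (u , step3≡nothing)

lemma3p1 : (k n : ℕ) (H : Hypergraph n) → 3 ≤ k → Uniform k H → TwoColorable H →
    (∃ λ c → Output k H c) × (∀ c → Output k H c → Proper H c)
lemma3p1 k n H _ _ twoColourable = output-exists twoColourable , λ c → output-proper twoColourable
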